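{- Let $G$ be an undirected graph with non-negative edge weights cellularly embedded on an orientable surface $\Sigma$ without boundary, and let $s$ be any vertex of $G$. If $X$ is a global minimum cut in $G$, then $X^*$ is a minimum-weight separating subgraph of $G^*$ in the surface $\Sigma\setminus s^*$.
   Context: $G^*$ is the dual graph (a vertex per face of $G$, an edge $e^*$ per edge $e$ of $G$ with the same weight), cellularly embedded on $\Sigma$ with a face $v^*$ for each vertex $v$ of $G$; $X^*=\{e^*: e\in X\}$. $\Sigma\setminus s^*$ is $\Sigma$ with the interior of the face $s^*$ removed, a surface with one boundary component on which $G^*$ is embedded. A cut of $G$ is the set of edges between $S$ and $V\setminus S$ for some $\emptyset\ne S\subsetneq V$; a global minimum cut is a cut of minimum total weight. A separating subgraph of $G^*$ in $\Sigma\setminus s^*$ is the boundary of the union of a non-empty set of faces of $G^*$ other than $s^*$, i.e. the set of edges having an odd number of sides on faces of that set.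
   Formalization: The edge weights of G, and so those of G*, take values in the non-negative rationals rather than the reals. -}

module Defs where

-- Combinatorial encoding of a graph cellularly embedded on an orientable
-- surface without boundary: a (connected) combinatorial map / rotation system.
--   darts   : Fin n
--   α       : fixed-point-free involution (the two darts = half-edges of an edge)
--   σ       : permutation (rotation of darts around each vertex)
--   vertices of G : orbits of σ;  edges of G : orbits of α;
--   faces of G    : orbits of φ = σ ∘ α.
-- Connected maps of this kind are exactly cellular embeddings of connected
-- graphs (loops and parallel edges allowed) on closed orientable surfaces.

open import Data.Nat using (ℕ; _<ᵇ_)
open import Data.Fin using (Fin; zero; suc; toℕ)
open import Data.Bool using (Bool; true; false; _∧_; _xor_; if_then_else_)
open import Data.Rational using (ℚ; 0ℚ; _+_; _≤_)
open import Data.Product using (Σ; ∃; _×_; _,_)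
open import Relation.Binary.PropositionalEquality using (_≡_; _≢_)
open import Function using (_∘_)

data Reach {n : ℕ} (σ α : Fin n → Fin n) : Fin n → Fin n → Set where
  here  : ∀ {d} → Reach σ α d d
  viaσ  : ∀ {d e} → Reach σ α (σ d) e → Reach σ α d e
  viaα  : ∀ {d e} → Reach σ α (α d) e → Reach σ α d e

record CombMap : Set where
  field
    n        : ℕ
    σ        : Fin n → Fin n
    σ⁻¹      : Fin n → Fin n
    σ-inv₁   : ∀ d → σ (σ⁻¹ d) ≡ d
    σ-inv₂   : ∀ d → σ⁻¹ (σ d) ≡ d
    α        : Fin n → Fin n
    α-invol  : ∀ d → α (α d) ≡ d
    α-nofix  : ∀ d → α d ≢ d
    connected : ∀ d e → Reach σ α d e

  φ : Fin n → Fin n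
  φ = σ ∘ α

-- The dual map G*: vertices of G* = faces of G, edges e* = edges e (same
-- darts), faces of G* = orbits of φ* = σ* ∘ α* = φ ∘ α = σ, i.e. vertices of G.
-- A dart d is a side of the dual edge e* = {d, α d}, lying on the dual face
-- containing d.
dualPerm : (M : CombMap) → Fin (CombMap.n M) → Fin (CombMap.n M)
dualPerm M = CombMap.φ M

dualFacePerm : (M : CombMap) → Fin (CombMap.n M) → Fin (CombMap.n M)
dualFacePerm M = dualPerm M ∘ CombMap.α M

module _ (M : CombMap) where
  open CombMap M

  DartSet : Set
  DartSet = Fin n → Bool

  -- a set of edges of G = a dart set closed under α
  -- (each edge is the α-orbit {d, α d})

  IsVertexSet : DartSet → Set
  IsVertexSet S = ∀ d → S d ≡ true → S (σ d) ≡ true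

  IsDualFaceSet : DartSet → Set
  IsDualFaceSet F = ∀ d → F d ≡ true → F (dualFacePerm M d) ≡ true

  _≐_ : DartSet → DartSet → Set
  X ≐ Y = ∀ d → X d ≡ Y d

  cutOf : DartSet → DartSet
  cutOf S d = S d xor S (α d)

  IsCut : DartSet → Set
  IsCut X = Σ DartSet λ S → IsVertexSet S × (∃ λ d → S d ≡ true)
              × (∃ λ d → S d ≡ false) × (X ≐ cutOf S)

  -- the dual edge set X* (e* has the same darts as e)
  dualEdges : DartSet → DartSet
  dualEdges X = X

  -- boundary of a set F of faces of G*: edges e* having an odd number of
  -- sides (darts d, α d) on faces in F
  boundary : DartSet → DartSet
  boundary F d = F d xor F (α d)

  -- separating subgraph of G* in Σ ∖ s*, where the vertex s of G (= face s*
  -- of G*) is given by one of its darts s₀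
  IsSeparating : Fin n → DartSet → Set
  IsSeparating s₀ Y = Σ DartSet λ F → IsDualFaceSet F × (∃ λ d → F d ≡ true)
              × F s₀ ≡ false × (Y ≐ boundary F)

module _ (M : CombMap) (w : Fin (CombMap.n M) → ℚ) where
  open CombMap M

  sumFin : (m : ℕ) → (Fin m → ℚ) → ℚ
  sumFin ℕ.zero f = 0ℚ
  sumFin (ℕ.suc m) f = f zero + sumFin m (f ∘ suc)

  -- total weight of an α-closed dart set: one representative dart per edge
  weight : DartSet M → ℚ
  weight X = sumFin n (λ d → if X d ∧ (toℕ d <ᵇ toℕ (α d)) then w d else 0ℚ)

  IsEdgeWeight : Set
  IsEdgeWeight = (∀ d → w (α d) ≡ w d) × (∀ d → 0ℚ ≤ w d)

  IsGlobalMinCut : DartSet M → Set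
  IsGlobalMinCut X = IsCut M X × (∀ Y → IsCut M Y → weight X ≤ weight Y)

  -- minimum-weight separating subgraph of G* in Σ ∖ s* (dual weights w* = w)
  IsMinSeparating : Fin n → DartSet M → Set
  IsMinSeparating s₀ Y = IsSeparating M s₀ Y
    × (∀ Z → IsSeparating M s₀ Z → weight Y ≤ weight Z)

{-# OPTIONS --safe #-}
-- The face permutation of the dual map is φ ∘ α = σ, so faces of G* are the
-- vertices of G and the boundary of a set of dual faces is the cut of the same
-- set of vertices.  A separating subgraph of G* in Σ ∖ s* is therefore a cut of
-- G.  Conversely δ(S) = δ(V ∖ S) and one of S, V ∖ S avoids s, so every cut is
-- such a separating subgraph; V ∖ S is again a union of σ-orbits because σ is
-- an injection of a finite set, so every dart lies on a σ-cycle.  The two families of edge sets coincide, with the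
-- same weights.
module Submission where

open import Defs
open import Data.Bool using (Bool; true; false; not; _xor_)
open import Data.Bool.Properties
  using (not-distribˡ-xor; not-distribʳ-xor; not-involutive)
open import Data.Fin using (Fin; toℕ)
open import Data.Fin.Properties using (pigeonhole)
open import Data.Nat using (ℕ; zero; suc; _+_)
open import Data.Nat.GeneralisedArithmetic using (iterate)
open import Data.Nat.Properties using (n<1+n; m≤n⇒∃[o]m+o≡n; +-comm)
open import Data.Product using (∃; _,_)
open import Data.Rational using (ℚ)
open import Function using (_∘_)
open import Function.Definitions using (Injective)
open import Relation.Binary.PropositionalEquality
  using (_≡_; refl; sym; trans; cong; subst; module ≡-Reasoning)
open import Relation.Nullary using (contradiction)

module _ {A : Set} (f : A → A) where

  iterate-+ : ∀ x m k → iterate f x (m + k) ≡ iterate f (iterate f x m) k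
  iterate-+ x zero    k = refl
  iterate-+ x (suc m) k = iterate-+ (f x) m k

  iterate-injective : Injective _≡_ _≡_ f → ∀ k → Injective _≡_ _≡_ (λ x → iterate f x k)
  iterate-injective f-inj zero    eq = eq
  iterate-injective f-inj (suc k) eq = f-inj (iterate-injective f-inj k eq)

  Closed : (A → Bool) → Set
  Closed S = ∀ d → S d ≡ true → S (f d) ≡ true

  Closed-iterate : ∀ {S} → Closed S → ∀ {x} k → S x ≡ true → S (iterate f x k) ≡ true
  Closed-iterate S-closed zero    Sx = Sx
  Closed-iterate S-closed (suc k) Sx = Closed-iterate S-closed k (S-closed _ Sx)

module _ {n : ℕ} (f : Fin n → Fin n) (f-injective : Injective _≡_ _≡_ f) where

  iterate-returns : ∀ x → ∃ λ k → iterate f (f x) k ≡ x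
  iterate-returns x
    with i , j , i<j , fⁱx≡fʲx ← pigeonhole (n<1+n n) (λ (i : Fin (suc n)) → iterate f x (toℕ i))
    with k , 1+i+k≡j ← m≤n⇒∃[o]m+o≡n i<j
    = k , sym (iterate-injective f f-injective (toℕ i) fⁱx≡fⁱfᵏfx)
    where
    open ≡-Reasoning
    fⁱx≡fⁱfᵏfx : iterate f x (toℕ i) ≡ iterate f (iterate f (f x) k) (toℕ i)
    fⁱx≡fⁱfᵏfx = begin
      iterate f x (toℕ i)                       ≡⟨ fⁱx≡fʲx ⟩
      iterate f x (toℕ j)                       ≡⟨ cong (iterate f x) (sym 1+i+k≡j) ⟩
      iterate f x (suc (toℕ i + k))             ≡⟨ cong (iterate f x ∘ suc) (+-comm (toℕ i) k) ⟩
      iterate f x (suc k + toℕ i)               ≡⟨ iterate-+ f x (suc k) (toℕ i) ⟩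
      iterate f (iterate f (f x) k) (toℕ i)     ∎

  Closed-backward : ∀ {S} → Closed f S → ∀ d → S (f d) ≡ true → S d ≡ true
  Closed-backward {S} S-closed d Sfd =
    let k , fᵏfd≡d = iterate-returns d
    in subst (λ x → S x ≡ true) fᵏfd≡d (Closed-iterate f S-closed k Sfd)

  Closed-∁ : ∀ {S} → Closed f S → Closed f (not ∘ S)
  Closed-∁ {S} S-closed d ¬Sd with S d in Sd | S (f d) in Sfd
  ... | true  | _     = contradiction ¬Sd λ ()
  ... | false | false = refl
  ... | false | true  = contradiction (trans (sym Sd) (Closed-backward S-closed d Sfd)) λ ()

not-xor-not : ∀ x y → not x xor not y ≡ x xor y
not-xor-not x y = begin
  not x xor not y       ≡⟨ not-distribˡ-xor x (not y) ⟨
  not (x xor not y)     ≡⟨ cong not (not-distribʳ-xor x y) ⟨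
  not (not (x xor y))   ≡⟨ not-involutive (x xor y) ⟩
  x xor y               ∎
  where open ≡-Reasoning

module _ (M : CombMap) where
  open CombMap M

  σ-injective : Injective _≡_ _≡_ σ
  σ-injective {x} {y} σx≡σy = begin
    x             ≡⟨ σ-inv₂ x ⟨
    σ⁻¹ (σ x)     ≡⟨ cong σ⁻¹ σx≡σy ⟩
    σ⁻¹ (σ y)     ≡⟨ σ-inv₂ y ⟩
    y             ∎
    where open ≡-Reasoning

  dualFacePerm≗σ : ∀ d → dualFacePerm M d ≡ σ d
  dualFacePerm≗σ d = cong σ (α-invol d)

  vertexSet⇒dualFaceSet : ∀ {S} → IsVertexSet M S → IsDualFaceSet M S
  vertexSet⇒dualFaceSet {S} S-closed d Sd =
    subst (λ x → S x ≡ true) (sym (dualFacePerm≗σ d)) (S-closed d Sd)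

  dualFaceSet⇒vertexSet : ∀ {F} → IsDualFaceSet M F → IsVertexSet M F
  dualFaceSet⇒vertexSet {F} F-closed d Fd =
    subst (λ x → F x ≡ true) (dualFacePerm≗σ d) (F-closed d Fd)

  cutOf-∁ : ∀ S → _≐_ M (cutOf M (not ∘ S)) (cutOf M S)
  cutOf-∁ S d = not-xor-not (S d) (S (α d))

  cut⇒separating : ∀ s₀ {X} → IsCut M X → IsSeparating M s₀ (dualEdges M X)
  cut⇒separating s₀ (S , S-closed , (d₁ , Sd₁) , (d₂ , ¬Sd₂) , X≐δS) with S s₀ in Ss₀
  ... | false = S , vertexSet⇒dualFaceSet S-closed , (d₁ , Sd₁) , Ss₀ , X≐δS
  ... | true  = not ∘ S , vertexSet⇒dualFaceSet (Closed-∁ σ σ-injective S-closed)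
              , (d₂ , cong not ¬Sd₂) , cong not Ss₀
              , λ d → trans (X≐δS d) (sym (cutOf-∁ S d))

  separating⇒cut : ∀ {s₀ Z} → IsSeparating M s₀ Z → IsCut M Z
  separating⇒cut {s₀} (F , F-closed , F-nonempty , Fs₀ , Z≐∂F) =
    F , dualFaceSet⇒vertexSet F-closed , F-nonempty , (s₀ , Fs₀) , Z≐∂F

lemma7p1 : (M : CombMap) (w : Fin (CombMap.n M) → ℚ) → IsEdgeWeight M w →
    (s₀ : Fin (CombMap.n M)) (X : DartSet M) → IsGlobalMinCut M w X →
    IsMinSeparating M w s₀ (dualEdges M X)
lemma7p1 M w _ s₀ X (X-cut , X-minimum) =
  cut⇒separating M s₀ X-cut , λ Z Z-separating → X-minimum Z (separating⇒cut M Z-separating)
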